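{- Let $s\geq 4$ be an even integer and let $t\geq 3$ be an integer with $t \not\equiv 2, 4, 6, \dots, s-2 \pmod{s}$. Then for every integer $n\geq 0$, \[ C_{s}^{t}(n)=E_{s}^{t}(n). \]
   Context: $C_s^t(n)$ is the number of partitions of $n$ into parts not congruent to $2,4,\dots,s-2$ modulo $s$, in which each part appears fewer than $t$ times. $E_{s}^{t}(n)$ is the number of partitions of $n$ into parts that are not congruent to any of $2,4,\dots,s-2$ modulo $s$ and not congruent to any of $0$ and $t(2r+1)$, $r=0,1,\dots,s/2-1$, modulo $ts$. -}

module Defs where

open import Data.Nat using (ℕ; zero; suc; _+_; _*_; _∸_; _/_; _%_; _<ᵇ_; _≡ᵇ_)
open import Data.Bool using (Bool; true; false; _∧_; _∨_; not)
open import Data.List using (List; []; _∷_; map; concatMap; upTo; length; filter)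
open import Data.Bool.ListAction using (any; all)

-- residue of k modulo m (only used with m ≥ 1; the m = 0 clause is a dummy)
res : ℕ → ℕ → ℕ
res zero    k = k
res (suc m) k = k % suc m

-- k ≡ 2, 4, …, s-2 (mod s), i.e. k mod s = 2(j+1) for some j < s/2 - 1
evenClass : (s k : ℕ) → Bool
evenClass s k = any (λ j → res s k ≡ᵇ 2 * suc j) (upTo (s / 2 ∸ 1))

-- k ≡ 0 (mod ts) or k ≡ t(2r+1) (mod ts) for some r = 0,…,s/2-1
tClass : (s t k : ℕ) → Bool
tClass s t k = (res (t * s) k ≡ᵇ 0)
             ∨ any (λ r → res (t * s) k ≡ᵇ t * (2 * r + 1)) (upTo (s / 2))

-- A partition of n is encoded by its multiplicity list (m₁, m₂, …, mₙ):
-- mₖ = number of times the part k occurs.  Every partition of n has mₖ ≤ n,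
-- so the partitions of n correspond exactly to the lists of length n with
-- entries in {0,…,n} and Σ k·mₖ = n.

vecs : (len b : ℕ) → List (List ℕ)
vecs zero    b = [] ∷ []
vecs (suc l) b = concatMap (λ x → map (x ∷_) (vecs l b)) (upTo (suc b))

weightFrom : ℕ → List ℕ → ℕ
weightFrom k []       = 0
weightFrom k (m ∷ ms) = k * m + weightFrom (suc k) ms

partsOK : (ℕ → Bool) → ℕ → List ℕ → Bool
partsOK ok k []       = true
partsOK ok k (m ∷ ms) = ((m ≡ᵇ 0) ∨ ok k) ∧ partsOK ok (suc k) ms

multOK : ℕ → List ℕ → Bool
multOK t ms = all (λ m → m <ᵇ t) ms

partitionsOf : ℕ → List (List ℕ)
partitionsOf n = filter (λ ms → Data.Nat._≟_ (weightFrom 1 ms) n) (vecs n n)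

count : {A : Set} → (A → Bool) → List A → ℕ
count p []       = 0
count p (x ∷ xs) with p x
... | true  = suc (count p xs)
... | false = count p xs

C : (s t n : ℕ) → ℕ
C s t n = count (λ ms → partsOK (λ k → not (evenClass s k)) 1 ms ∧ multOK t ms)
                (partitionsOf n)

E : (s t n : ℕ) → ℕ
E s t n = count (λ ms → partsOK (λ k → not (evenClass s k) ∧ not (tClass s t k)) 1 ms)
                (partitionsOf n)

{-# OPTIONS --safe #-}
-- Both counts are coefficients of q^n in products of generating functions, computed
-- modulo q^(n+1) with natural-number coefficients. Write A for the allowed parts (not
-- ≡ 2,4,…,s-2 mod s), T for the parts ≡ 0, t(2r+1) mod ts, G j = 1/(1-q^j) and [b] f for
-- "f if b, else 1". The C-side is ∏ [A j] (1 + q^j + ⋯ + q^((t-1)j)) and the E-side is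
-- ∏ [A j ∧ ¬ T j] G j. Since (1 + q^j + ⋯ + q^((t-1)j)) G (tj) = G j, multiplying the
-- C-side by X = ∏ [A j] G (tj) and the E-side by Y = ∏ [A j ∧ T j] G j gives ∏ [A j] G j
-- on both sides, and X = Y: T contains only multiples of t, and A (tj) ∧ T (tj) = A j
-- because t is odd or divisible by s. As X has constant term 1 it can be cancelled.
module Submission where

open import Algebra.Bundles using (CommutativeMonoid)
import Algebra.Properties.CommutativeSemigroup as CommutativeSemigroupProperties
open import Data.Bool using (Bool; true; false; if_then_else_; _∧_; _∨_; not)
open import Data.Bool.ListAction using (any)
open import Data.Bool.Properties using (∧-zeroʳ; ∨-zeroʳ; ∧-commutativeMonoid)
open import Data.List using (List; []; _∷_; _++_; map; concatMap; upTo; applyUpTo; filter)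
open import Data.Nat using (ℕ; zero; suc; _+_; _*_; _∸_; _≤_; _<_; z≤n; s≤s; z<s; s<s; _≡ᵇ_; _<ᵇ_; >-nonZero)
open import Data.Nat.DivMod
  using (_/_; _%_; m≡m%n+[m/n]*n; m%n<n; m*n%n≡0; [m+kn]%n≡m%n; m∣n⇒o%n%m≡o%m; %-congʳ; m%n*o≡m*o%[n*o]; m<n*o⇒m/o<n; %-distribˡ-*)
open import Data.Nat.Divisibility
  using (_∣_; _∤_; >⇒∤; ∣m+n∣m⇒∣n; m∣m*n; n∣m*n; ∣-trans; m%n≡0⇒n∣m; n∣m⇒m%n≡0)
open import Data.Nat.Induction using (<-rec)
open import Data.Nat.Properties
open import Data.Nat.Solver using (module +-*-Solver)
open import Data.Product using (_,_)
open import Data.Sum using (_⊎_; inj₁; inj₂)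
open import Function using (_∘_; id)
open import Relation.Binary.Bundles using (Setoid)
open import Relation.Binary.PropositionalEquality
import Relation.Binary.Reasoning.Setoid as SetoidReasoning
open import Relation.Nullary using (Dec; does; yes; no; ¬_; contradiction)
open import Relation.Nullary.Decidable using (dec-false; dec-true; _⊎-dec_)
open import Relation.Unary using (Decidable)

open import Defs

open +-*-Solver
open CommutativeSemigroupProperties +-commutativeSemigroup using () renaming (interchange to +-interchange)
open CommutativeSemigroupProperties (CommutativeMonoid.commutativeSemigroup ∧-commutativeMonoid)
  using () renaming (interchange to ∧-interchange)

-- Power series with natural-number coefficients

Series : Set
Series = ℕ → ℕ

infix  4 _≈_ _≈[_]_
infixl 6 _⊕_
infixl 7 _⊛_

𝟘 : Series
𝟘 _ = 0

q^_ : ℕ → Series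
(q^ zero)  zero    = 1
(q^ zero)  (suc i) = 0
(q^ suc d) zero    = 0
(q^ suc d) (suc i) = (q^ d) i

𝟙 : Series
𝟙 = q^ 0

_⊕_ : Series → Series → Series
(f ⊕ g) i = f i + g i

_⊛_ : Series → Series → Series
(f ⊛ g) zero    = f 0 * g 0
(f ⊛ g) (suc n) = f 0 * g (suc n) + ((f ∘ suc) ⊛ g) n

_≈_ : Series → Series → Set
f ≈ g = ∀ i → f i ≡ g i

_≈[_]_ : Series → ℕ → Series → Set
f ≈[ N ] g = ∀ i → i ≤ N → f i ≡ g i

≈-refl : ∀ {f} → f ≈ f
≈-refl _ = refl

≈[]-refl : ∀ {N f} → f ≈[ N ] f
≈[]-refl _ _ = refl

≈⇒≈[] : ∀ {N f g} → f ≈ g → f ≈[ N ] g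
≈⇒≈[] f≈g i _ = f≈g i

≈[]-setoid : ℕ → Setoid _ _
≈[]-setoid N = record
  { Carrier       = Series
  ; _≈_           = _≈[ N ]_
  ; isEquivalence = record
    { refl  = ≈[]-refl
    ; sym   = λ f≈g i i≤N → sym (f≈g i i≤N)
    ; trans = λ f≈g g≈h i i≤N → trans (f≈g i i≤N) (g≈h i i≤N)
    }
  }

module ≈[]-Reasoning (N : ℕ) where
  open SetoidReasoning (≈[]-setoid N) public

  infixr 2 step-≐-⟩ step-≐-⟨
  step-≐-⟩ : ∀ f {g h} → g IsRelatedTo h → f ≈ g → f IsRelatedTo h
  step-≐-⟩ f g∼h f≈g = step-≈-⟩ f g∼h (≈⇒≈[] f≈g)
  step-≐-⟨ : ∀ f {g h} → g IsRelatedTo h → g ≈ f → f IsRelatedTo h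
  step-≐-⟨ f g∼h g≈f = step-≈-⟨ f g∼h (≈⇒≈[] g≈f)
  syntax step-≐-⟩ f g∼h f≈g = f ≐⟨ f≈g ⟩ g∼h
  syntax step-≐-⟨ f g∼h g≈f = f ≐⟨ g≈f ⟨ g∼h

≈[]-induction : ∀ {N f g} → (∀ i → i ≤ N → (∀ k → k < i → f k ≡ g k) → f i ≡ g i) → f ≈[ N ] g
≈[]-induction {N} {f} {g} step = <-rec (λ i → i ≤ N → f i ≡ g i)
  λ i rec i≤N → step i i≤N (λ k k<i → rec k<i (≤-trans (<⇒≤ k<i) i≤N))

⊕-cong : ∀ {f f′ g g′} → f ≈ f′ → g ≈ g′ → f ⊕ g ≈ f′ ⊕ g′
⊕-cong f≈ g≈ i = cong₂ _+_ (f≈ i) (g≈ i)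

⊕-cong[] : ∀ {N f f′ g g′} → f ≈[ N ] f′ → g ≈[ N ] g′ → f ⊕ g ≈[ N ] f′ ⊕ g′
⊕-cong[] f≈ g≈ i i≤N = cong₂ _+_ (f≈ i i≤N) (g≈ i i≤N)

⊛-cong[] : ∀ {N f f′ g g′} → f ≈[ N ] f′ → g ≈[ N ] g′ → f ⊛ g ≈[ N ] f′ ⊛ g′
⊛-cong[] f≈ g≈ zero    _ = cong₂ _*_ (f≈ 0 z≤n) (g≈ 0 z≤n)
⊛-cong[] {suc N} f≈ g≈ (suc i) (s≤s i≤N) =
  cong₂ _+_ (cong₂ _*_ (f≈ 0 z≤n) (g≈ (suc i) (s≤s i≤N)))
            (⊛-cong[] (λ k k≤N → f≈ (suc k) (s≤s k≤N)) (λ k k≤N → g≈ k (m≤n⇒m≤1+n k≤N)) i i≤N)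

⊛-cong : ∀ {f f′ g g′} → f ≈ f′ → g ≈ g′ → f ⊛ g ≈ f′ ⊛ g′
⊛-cong f≈ g≈ i = ⊛-cong[] (≈⇒≈[] f≈) (≈⇒≈[] g≈) i ≤-refl

⊛-zeroˡ : ∀ g → 𝟘 ⊛ g ≈ 𝟘
⊛-zeroˡ g zero    = refl
⊛-zeroˡ g (suc n) = ⊛-zeroˡ g n

⊛-identityˡ : ∀ g → 𝟙 ⊛ g ≈ g
⊛-identityˡ g zero    = +-identityʳ (g 0)
⊛-identityˡ g (suc n) = begin
  g (suc n) + 0 + (𝟘 ⊛ g) n ≡⟨ cong₂ _+_ (+-identityʳ (g (suc n))) (⊛-zeroˡ g n) ⟩
  g (suc n) + 0             ≡⟨ +-identityʳ (g (suc n)) ⟩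
  g (suc n)                 ∎
  where open ≡-Reasoning

⊛-unconsʳ : ∀ f g n → (f ⊛ g) (suc n) ≡ (f ⊛ (g ∘ suc)) n + f (suc n) * g 0
⊛-unconsʳ f g zero    = refl
⊛-unconsʳ f g (suc n) = begin
  f 0 * g (suc (suc n)) + ((f ∘ suc) ⊛ g) (suc n)
    ≡⟨ cong (f 0 * g (suc (suc n)) +_) (⊛-unconsʳ (f ∘ suc) g n) ⟩
  f 0 * g (suc (suc n)) + (((f ∘ suc) ⊛ (g ∘ suc)) n + f (suc (suc n)) * g 0)
    ≡⟨ +-assoc (f 0 * g (suc (suc n))) _ _ ⟨
  f 0 * g (suc (suc n)) + ((f ∘ suc) ⊛ (g ∘ suc)) n + f (suc (suc n)) * g 0 ∎
  where open ≡-Reasoning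

⊛-comm : ∀ f g → f ⊛ g ≈ g ⊛ f
⊛-comm f g zero    = *-comm (f 0) (g 0)
⊛-comm f g (suc n) = begin
  f 0 * g (suc n) + ((f ∘ suc) ⊛ g) n ≡⟨ cong₂ _+_ (*-comm (f 0) (g (suc n))) (⊛-comm (f ∘ suc) g n) ⟩
  g (suc n) * f 0 + (g ⊛ (f ∘ suc)) n ≡⟨ +-comm (g (suc n) * f 0) _ ⟩
  (g ⊛ (f ∘ suc)) n + g (suc n) * f 0 ≡⟨ ⊛-unconsʳ g f n ⟨
  (g ⊛ f) (suc n)                     ∎
  where open ≡-Reasoning

⊛-identityʳ : ∀ f → f ⊛ 𝟙 ≈ f
⊛-identityʳ f i = trans (⊛-comm f 𝟙 i) (⊛-identityˡ f i)

⊛-distribʳ : ∀ f f′ g → (f ⊕ f′) ⊛ g ≈ f ⊛ g ⊕ f′ ⊛ g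
⊛-distribʳ f f′ g zero    = *-distribʳ-+ (g 0) (f 0) (f′ 0)
⊛-distribʳ f f′ g (suc n) = begin
  (f 0 + f′ 0) * g (suc n) + ((f ∘ suc ⊕ f′ ∘ suc) ⊛ g) n
    ≡⟨ cong₂ _+_ (*-distribʳ-+ (g (suc n)) (f 0) (f′ 0)) (⊛-distribʳ (f ∘ suc) (f′ ∘ suc) g n) ⟩
  f 0 * g (suc n) + f′ 0 * g (suc n) + (((f ∘ suc) ⊛ g) n + ((f′ ∘ suc) ⊛ g) n)
    ≡⟨ +-interchange (f 0 * g (suc n)) _ _ _ ⟩
  f 0 * g (suc n) + ((f ∘ suc) ⊛ g) n + (f′ 0 * g (suc n) + ((f′ ∘ suc) ⊛ g) n) ∎
  where open ≡-Reasoning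

⊛-distribˡ : ∀ f g g′ → f ⊛ (g ⊕ g′) ≈ f ⊛ g ⊕ f ⊛ g′
⊛-distribˡ f g g′ i = begin
  (f ⊛ (g ⊕ g′)) i        ≡⟨ ⊛-comm f (g ⊕ g′) i ⟩
  ((g ⊕ g′) ⊛ f) i        ≡⟨ ⊛-distribʳ g g′ f i ⟩
  (g ⊛ f) i + (g′ ⊛ f) i  ≡⟨ cong₂ _+_ (⊛-comm g f i) (⊛-comm g′ f i) ⟩
  (f ⊛ g) i + (f ⊛ g′) i  ∎
  where open ≡-Reasoning

⊛-scaleˡ : ∀ c f g → (λ i → c * f i) ⊛ g ≈ (λ i → c * (f ⊛ g) i)
⊛-scaleˡ c f g zero    = *-assoc c (f 0) (g 0)
⊛-scaleˡ c f g (suc n) = begin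
  c * f 0 * g (suc n) + ((λ i → c * f (suc i)) ⊛ g) n
    ≡⟨ cong₂ _+_ (*-assoc c (f 0) _) (⊛-scaleˡ c (f ∘ suc) g n) ⟩
  c * (f 0 * g (suc n)) + c * ((f ∘ suc) ⊛ g) n
    ≡⟨ *-distribˡ-+ c _ _ ⟨
  c * (f 0 * g (suc n) + ((f ∘ suc) ⊛ g) n) ∎
  where open ≡-Reasoning

⊛-assoc : ∀ f g h → (f ⊛ g) ⊛ h ≈ f ⊛ (g ⊛ h)
⊛-assoc f g h zero    = *-assoc (f 0) (g 0) (h 0)
⊛-assoc f g h (suc n) = begin
  f 0 * g 0 * h (suc n) + (((λ i → f 0 * g (suc i)) ⊕ (f ∘ suc) ⊛ g) ⊛ h) n
    ≡⟨ cong (f 0 * g 0 * h (suc n) +_) (⊛-distribʳ (λ i → f 0 * g (suc i)) ((f ∘ suc) ⊛ g) h n) ⟩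
  f 0 * g 0 * h (suc n) + (((λ i → f 0 * g (suc i)) ⊛ h) n + ((f ∘ suc) ⊛ g ⊛ h) n)
    ≡⟨ cong (f 0 * g 0 * h (suc n) +_) (cong₂ _+_ (⊛-scaleˡ (f 0) (g ∘ suc) h n) (⊛-assoc (f ∘ suc) g h n)) ⟩
  f 0 * g 0 * h (suc n) + (f 0 * ((g ∘ suc) ⊛ h) n + ((f ∘ suc) ⊛ (g ⊛ h)) n)
    ≡⟨ solve 5 (λ a b c d e → a :* b :* c :+ (a :* d :+ e) := a :* (b :* c :+ d) :+ e) refl
               (f 0) (g 0) (h (suc n)) (((g ∘ suc) ⊛ h) n) (((f ∘ suc) ⊛ (g ⊛ h)) n) ⟩
  f 0 * (g 0 * h (suc n) + ((g ∘ suc) ⊛ h) n) + ((f ∘ suc) ⊛ (g ⊛ h)) n ∎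
  where open ≡-Reasoning

⊛-commutativeMonoid : CommutativeMonoid _ _
⊛-commutativeMonoid = record
  { Carrier = Series
  ; _≈_ = _≈_
  ; _∙_ = _⊛_
  ; ε = 𝟙
  ; isCommutativeMonoid = record
    { isMonoid = record
      { isSemigroup = record
        { isMagma = record
          { isEquivalence = record
            { refl  = ≈-refl
            ; sym   = λ f≈g i → sym (f≈g i)
            ; trans = λ f≈g g≈h i → trans (f≈g i) (g≈h i)
            }
          ; ∙-cong = ⊛-cong
          }
        ; assoc = ⊛-assoc
        }
      ; identity = ⊛-identityˡ , ⊛-identityʳ
      }
    ; comm = ⊛-comm
    }
  }

open CommutativeSemigroupProperties (CommutativeMonoid.commutativeSemigroup ⊛-commutativeMonoid)
  using () renaming (interchange to ⊛-interchange)

q^-⊛-q^ : ∀ a b → q^ a ⊛ q^ b ≈ q^ (a + b)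
q^-⊛-q^ zero    b i       = ⊛-identityˡ (q^ b) i
q^-⊛-q^ (suc a) b zero    = refl
q^-⊛-q^ (suc a) b (suc i) = q^-⊛-q^ a b i

q^-⊛-at : ∀ d g i → (q^ d ⊛ g) (d + i) ≡ g i
q^-⊛-at zero    g i = ⊛-identityˡ g i
q^-⊛-at (suc d) g i = q^-⊛-at d g i

q^-⊛-below : ∀ d g i → i < d → (q^ d ⊛ g) i ≡ 0
q^-⊛-below (suc d) g zero    _         = refl
q^-⊛-below (suc d) g (suc i) (s≤s i<d) = q^-⊛-below d g i i<d

q^-vanish : ∀ {N} d → N < d → q^ d ≈[ N ] 𝟘
q^-vanish (suc d) _         zero    _         = refl
q^-vanish (suc d) (s≤s N<d) (suc i) (s≤s i≤N) = q^-vanish d N<d i i≤N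

⊛-cancelˡ[] : ∀ {N} p f g → p 0 ≡ 1 → p ⊛ f ≈[ N ] p ⊛ g → f ≈[ N ] g
⊛-cancelˡ[] {N} p f g p0≡1 pf≈pg = ≈[]-induction step
  where
  p0* : ∀ x → p 0 * x ≡ x
  p0* x = trans (cong (_* x) p0≡1) (*-identityˡ x)
  step : ∀ i → i ≤ N → (∀ k → k < i → f k ≡ g k) → f i ≡ g i
  step zero    i≤N _     = trans (sym (p0* (f 0))) (trans (pf≈pg 0 i≤N) (p0* (g 0)))
  step (suc i) i≤N f≈g = +-cancelʳ-≡ ((p ∘ suc ⊛ f) i) _ _ (begin
    f (suc i) + (p ∘ suc ⊛ f) i       ≡⟨ cong (_+ (p ∘ suc ⊛ f) i) (p0* (f (suc i))) ⟨
    (p ⊛ f) (suc i)                   ≡⟨ pf≈pg (suc i) i≤N ⟩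
    (p ⊛ g) (suc i)                   ≡⟨ cong₂ _+_ (p0* (g (suc i))) (sym tail≡) ⟩
    g (suc i) + (p ∘ suc ⊛ f) i       ∎)
    where
    open ≡-Reasoning
    tail≡ : (p ∘ suc ⊛ f) i ≡ (p ∘ suc ⊛ g) i
    tail≡ = ⊛-cong[] ≈[]-refl (λ k k≤i → f≈g k (s≤s k≤i)) i ≤-refl

q^suc-⊛-cong< : ∀ j {H K} i → (∀ k → k < i → H k ≡ K k) → (q^ suc j ⊛ H) i ≡ (q^ suc j ⊛ K) i
q^suc-⊛-cong< j zero    _   = refl
q^suc-⊛-cong< j (suc i) H≡K = ⊛-cong[] ≈[]-refl (λ k k≤i → H≡K k (s≤s k≤i)) i ≤-refl

fixpoint-unique : ∀ {N} j H K → H ≈[ N ] 𝟙 ⊕ q^ suc j ⊛ H → K ≈[ N ] 𝟙 ⊕ q^ suc j ⊛ K → H ≈[ N ] K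
fixpoint-unique j H K H≈ K≈ = ≈[]-induction λ i i≤N H≡K →
  trans (H≈ i i≤N) (trans (cong (𝟙 i +_) (q^suc-⊛-cong< j i H≡K)) (sym (K≈ i i≤N)))

-- Finite sums and products of series

sum : ℕ → (ℕ → Series) → Series
sum zero    F = 𝟘
sum (suc c) F = F 0 ⊕ sum c (F ∘ suc)

syntax sum c (λ x → F) = ∑[ x < c ] F

sum-cong[] : ∀ {N} c {F G} → (∀ x → x < c → F x ≈[ N ] G x) → sum c F ≈[ N ] sum c G
sum-cong[] zero    F≈G i i≤N = refl
sum-cong[] (suc c) F≈G i i≤N =
  cong₂ _+_ (F≈G 0 z<s i i≤N) (sum-cong[] c (λ x x<c → F≈G (suc x) (s<s x<c)) i i≤N)

sum-cong : ∀ c {F G} → (∀ x → x < c → F x ≈ G x) → sum c F ≈ sum c G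
sum-cong c F≈G i = sum-cong[] c (λ x x<c → ≈⇒≈[] (F≈G x x<c)) i ≤-refl

sum-zero[] : ∀ {N} c {F} → (∀ x → x < c → F x ≈[ N ] 𝟘) → sum c F ≈[ N ] 𝟘
sum-zero[] zero    F≈0 i i≤N = refl
sum-zero[] (suc c) F≈0 i i≤N =
  cong₂ _+_ (F≈0 0 z<s i i≤N) (sum-zero[] c (λ x x<c → F≈0 (suc x) (s<s x<c)) i i≤N)

sum-+ : ∀ c d F → sum (c + d) F ≈ sum c F ⊕ sum d (λ x → F (c + x))
sum-+ zero    d F i = refl
sum-+ (suc c) d F i = trans (cong (F 0 i +_) (sum-+ c d (F ∘ suc) i)) (sym (+-assoc (F 0 i) _ _))

sum-last : ∀ c F → sum (suc c) F ≈ sum c F ⊕ F c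
sum-last zero    F i = +-comm (F 0 i) 0
sum-last (suc c) F i = trans (cong (F 0 i +_) (sum-last c (F ∘ suc) i)) (sym (+-assoc (F 0 i) _ _))

sum-⊛ : ∀ c F g → sum c F ⊛ g ≈ ∑[ x < c ] (F x ⊛ g)
sum-⊛ zero    F g i = ⊛-zeroˡ g i
sum-⊛ (suc c) F g i = trans (⊛-distribʳ (F 0) (sum c (F ∘ suc)) g i) (cong ((F 0 ⊛ g) i +_) (sum-⊛ c (F ∘ suc) g i))

⊛-sum : ∀ c F g → g ⊛ sum c F ≈ ∑[ x < c ] (g ⊛ F x)
⊛-sum c F g i = begin
  (g ⊛ sum c F) i           ≡⟨ ⊛-comm g (sum c F) i ⟩
  (sum c F ⊛ g) i           ≡⟨ sum-⊛ c F g i ⟩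
  (∑[ x < c ] (F x ⊛ g)) i ≡⟨ sum-cong c (λ x _ → ⊛-comm (F x) g) i ⟩
  (∑[ x < c ] (g ⊛ F x)) i ∎
  where open ≡-Reasoning

sum-truncate : ∀ {N} c {c′ F} → (∀ x → c ≤ x → F x ≈[ N ] 𝟘) → c ≤ c′ → sum c′ F ≈[ N ] sum c F
sum-truncate {N} c {c′} {F} F≈0 c≤c′ = begin
  sum c′ F                                   ≡⟨ cong (λ c″ → sum c″ F) (m+[n∸m]≡n c≤c′) ⟨
  sum (c + (c′ ∸ c)) F                       ≐⟨ sum-+ c (c′ ∸ c) F ⟩
  sum c F ⊕ ∑[ x < c′ ∸ c ] F (c + x)       ≈⟨ ⊕-cong[] {f = sum c F} ≈[]-refl (sum-zero[] (c′ ∸ c) (λ x _ → F≈0 (c + x) (m≤m+n c x))) ⟩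
  sum c F ⊕ 𝟘                                ≐⟨ (λ i → +-identityʳ (sum c F i)) ⟩
  sum c F                                    ∎
  where open ≈[]-Reasoning N

prod : (ℕ → Series) → ℕ → ℕ → Series
prod F k zero    = 𝟙
prod F k (suc l) = F k ⊛ prod F (suc k) l

prod-cong[] : ∀ {N F G} k l → (∀ d → d < l → F (k + d) ≈[ N ] G (k + d)) → prod F k l ≈[ N ] prod G k l
prod-cong[] k zero    F≈G = ≈[]-refl
prod-cong[] {N} {F} {G} k (suc l) F≈G = ⊛-cong[] head (prod-cong[] (suc k) l tail)
  where
  head : F k ≈[ N ] G k
  head = subst (λ j → F j ≈[ N ] G j) (+-identityʳ k) (F≈G 0 z<s)
  tail : ∀ d → d < l → F (suc k + d) ≈[ N ] G (suc k + d)
  tail d d<l = subst (λ j → F j ≈[ N ] G j) (+-suc k d) (F≈G (suc d) (s<s d<l))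

prod-𝟙 : ∀ k l → prod (λ _ → 𝟙) k l ≈ 𝟙
prod-𝟙 k zero    i = refl
prod-𝟙 k (suc l) i = trans (⊛-cong ≈-refl (prod-𝟙 (suc k) l) i) (⊛-identityˡ 𝟙 i)

prod-trivial[] : ∀ {N F} k l → (∀ d → d < l → F (k + d) ≈[ N ] 𝟙) → prod F k l ≈[ N ] 𝟙
prod-trivial[] k l F≈1 i i≤N = trans (prod-cong[] k l F≈1 i i≤N) (prod-𝟙 k l i)

prod-⊛ : ∀ F G k l → prod F k l ⊛ prod G k l ≈ prod (λ j → F j ⊛ G j) k l
prod-⊛ F G k zero    i = ⊛-identityˡ 𝟙 i
prod-⊛ F G k (suc l) i =
  trans (⊛-interchange (F k) (prod F (suc k) l) (G k) (prod G (suc k) l) i)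
        (⊛-cong ≈-refl (prod-⊛ F G (suc k) l) i)

prod-+ : ∀ F k a b → prod F k (a + b) ≈ prod F k a ⊛ prod F (k + a) b
prod-+ F k zero    b i rewrite +-identityʳ k = sym (⊛-identityˡ (prod F k b) i)
prod-+ F k (suc a) b i rewrite +-suc k a =
  trans (⊛-cong ≈-refl (prod-+ F (suc k) a b) i) (sym (⊛-assoc (F k) _ _ i))

prod-constant-term : ∀ F k l → (∀ j → k ≤ j → F j 0 ≡ 1) → prod F k l 0 ≡ 1
prod-constant-term F k zero    F0≡1 = refl
prod-constant-term F k (suc l) F0≡1 =
  cong₂ _*_ (F0≡1 k ≤-refl) (prod-constant-term F (suc k) l (λ j k<j → F0≡1 j (<⇒≤ k<j)))

m∤m*n+o : ∀ {m} n {o} → 0 < o → o < m → m ∤ m * n + o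
m∤m*n+o n 0<o o<m m∣ = >⇒∤ {{>-nonZero 0<o}} o<m (∣m+n∣m⇒∣n m∣ (m∣m*n n))

module _ {N : ℕ} (t′ : ℕ) (F : ℕ → Series) (F≈𝟙 : ∀ k → suc t′ ∤ k → F k ≈[ N ] 𝟙) where
  private
    t = suc t′

  prod-block : ∀ m → prod F (suc (t * m)) t ≈[ N ] F (t * suc m)
  prod-block m = begin
    prod F (suc (t * m)) t                                ≡⟨ cong (prod F (suc (t * m))) (+-comm 1 t′) ⟩
    prod F (suc (t * m)) (t′ + 1)                         ≐⟨ prod-+ F (suc (t * m)) t′ 1 ⟩
    prod F (suc (t * m)) t′ ⊛ (F (suc (t * m) + t′) ⊛ 𝟙)  ≈⟨ ⊛-cong[] non-multiples (≈⇒≈[] (⊛-identityʳ _)) ⟩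
    𝟙 ⊛ F (suc (t * m) + t′)                              ≐⟨ ⊛-identityˡ _ ⟩
    F (suc (t * m) + t′)                                  ≡⟨ cong F (trans (cong suc (+-comm (t * m) t′)) (sym (*-suc t m))) ⟩
    F (t * suc m)                                         ∎
    where
    open ≈[]-Reasoning N
    non-multiples : prod F (suc (t * m)) t′ ≈[ N ] 𝟙
    non-multiples = prod-trivial[] (suc (t * m)) t′ λ d d<t′ →
      F≈𝟙 (suc (t * m) + d) (subst (t ∤_) (+-suc (t * m) d) (m∤m*n+o m z<s (s<s d<t′)))

  prod-blocks : ∀ M m → prod F (suc (t * m)) (t * M) ≈[ N ] prod (F ∘ (t *_)) (suc m) M
  prod-blocks zero    m = λ i _ → cong (λ l → prod F (suc (t * m)) l i) (*-zeroʳ t)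
  prod-blocks (suc M) m = begin
    prod F (suc (t * m)) (t * suc M)                                   ≡⟨ cong (prod F (suc (t * m))) (*-suc t M) ⟩
    prod F (suc (t * m)) (t + t * M)                                   ≐⟨ prod-+ F (suc (t * m)) t (t * M) ⟩
    prod F (suc (t * m)) t ⊛ prod F (suc (t * m) + t) (t * M)          ≡⟨ cong (λ k → prod F (suc (t * m)) t ⊛ prod F k (t * M)) next ⟩
    prod F (suc (t * m)) t ⊛ prod F (suc (t * suc m)) (t * M)          ≈⟨ ⊛-cong[] (prod-block m) (prod-blocks M (suc m)) ⟩
    F (t * suc m) ⊛ prod (F ∘ (t *_)) (suc (suc m)) M                  ∎
    where
    open ≈[]-Reasoning N
    next : suc (t * m) + t ≡ suc (t * suc m)
    next = cong suc (trans (+-comm (t * m) t) (sym (*-suc t m)))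

  prod-multiples : ∀ M r → r ≤ t′ → prod F 1 (t * M + r) ≈[ N ] prod (F ∘ (t *_)) 1 M
  prod-multiples M r r≤t′ = begin
    prod F 1 (t * M + r)                               ≐⟨ prod-+ F 1 (t * M) r ⟩
    prod F 1 (t * M) ⊛ prod F (suc (t * M)) r          ≡⟨ cong (λ k → prod F (suc k) (t * M) ⊛ prod F (suc (t * M)) r) (*-zeroʳ t) ⟨
    prod F (suc (t * 0)) (t * M) ⊛ prod F (suc (t * M)) r ≈⟨ ⊛-cong[] (prod-blocks M 0) tail ⟩
    prod (F ∘ (t *_)) 1 M ⊛ 𝟙                          ≐⟨ ⊛-identityʳ _ ⟩
    prod (F ∘ (t *_)) 1 M                              ∎
    where
    open ≈[]-Reasoning N
    tail : prod F (suc (t * M)) r ≈[ N ] 𝟙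
    tail = prod-trivial[] (suc (t * M)) r λ d d<r →
      F≈𝟙 (suc (t * M) + d) (subst (t ∤_) (+-suc (t * M) d) (m∤m*n+o M z<s (s<s (<-≤-trans d<r r≤t′))))

-- For j ≥ 1, geom j (suc N) represents 1/(1 - q^j) modulo q^(N+1).
geom : ℕ → ℕ → Series
geom j c = ∑[ x < c ] q^ (j * x)

geom-suc : ∀ j c → geom j (suc c) ≈ 𝟙 ⊕ q^ j ⊛ geom j c
geom-suc j c i = cong₂ _+_ (cong (λ d → (q^ d) i) (*-zeroʳ j)) (sym (begin
  (q^ j ⊛ geom j c) i                         ≡⟨ ⊛-sum c (λ x → q^ (j * x)) (q^ j) i ⟩
  (∑[ x < c ] (q^ j ⊛ q^ (j * x))) i          ≡⟨ sum-cong c (λ x _ → q^-⊛-q^ j (j * x)) i ⟩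
  (∑[ x < c ] q^ (j + j * x)) i               ≡⟨ sum-cong c (λ x _ k → cong (λ d → (q^ d) k) (*-suc j x)) i ⟨
  (∑[ x < c ] q^ (j * suc x)) i               ∎))
  where open ≡-Reasoning

geom-constant-term : ∀ j c → geom (suc j) (suc c) 0 ≡ 1
geom-constant-term j c = geom-suc (suc j) c 0

geom-truncate : ∀ {N} j c {c′} → N < j * c → c ≤ c′ → geom j c′ ≈[ N ] geom j c
geom-truncate j c N<jc = sum-truncate c (λ x c≤x → q^-vanish (j * x) (<-≤-trans N<jc (*-monoʳ-≤ j c≤x)))

geom-fixpoint : ∀ {N} j → geom (suc j) (suc N) ≈[ N ] 𝟙 ⊕ q^ suc j ⊛ geom (suc j) (suc N)
geom-fixpoint {N} j = begin
  geom (suc j) (suc N)                        ≈⟨ geom-truncate (suc j) (suc N) (m≤n*m (suc N) (suc j)) (n≤1+n (suc N)) ⟨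
  geom (suc j) (suc (suc N))                  ≐⟨ geom-suc (suc j) (suc N) ⟩
  𝟙 ⊕ q^ suc j ⊛ geom (suc j) (suc N)         ∎
  where open ≈[]-Reasoning N

geom-𝟙 : ∀ {N} j → N < j → geom j (suc N) ≈[ N ] 𝟙
geom-𝟙 {N} j N<j = begin
  geom j (suc N)   ≈⟨ geom-truncate j 1 {suc N} (subst (N <_) (sym (*-identityʳ j)) N<j) (s≤s z≤n) ⟩
  q^ (j * 0) ⊕ 𝟘   ≡⟨ cong (λ d → q^ d ⊕ 𝟘) (*-zeroʳ j) ⟩
  𝟙 ⊕ 𝟘            ≐⟨ (λ i → +-identityʳ (𝟙 i)) ⟩
  𝟙                ∎
  where open ≈[]-Reasoning N

geom-⊛-geom : ∀ {N} j c → geom (suc j) (suc c) ⊛ geom (suc c * suc j) (suc N) ≈[ N ] geom (suc j) (suc N)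
geom-⊛-geom {N} j c = fixpoint-unique j H (geom j′ (suc N)) H-fixpoint (geom-fixpoint j)
  where
  j′ = suc j
  G = geom (suc c * j′) (suc N)
  R = q^ j′ ⊛ geom j′ c
  H = geom j′ (suc c) ⊛ G
  shift : q^ j′ ⊛ geom j′ (suc c) ≈ R ⊕ q^ (suc c * j′)
  shift i = begin
    (q^ j′ ⊛ geom j′ (suc c)) i               ≡⟨ ⊛-cong ≈-refl (sum-last c (λ x → q^ (j′ * x))) i ⟩
    (q^ j′ ⊛ (geom j′ c ⊕ q^ (j′ * c))) i     ≡⟨ ⊛-distribˡ (q^ j′) (geom j′ c) _ i ⟩
    R i + (q^ j′ ⊛ q^ (j′ * c)) i             ≡⟨ cong (R i +_) (q^-⊛-q^ j′ (j′ * c) i) ⟩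
    R i + (q^ (j′ + j′ * c)) i                ≡⟨ cong (λ d → R i + (q^ (j′ + d)) i) (*-comm j′ c) ⟩
    R i + (q^ (suc c * j′)) i                 ∎
    where open ≡-Reasoning
  regroup : ∀ a b → 𝟙 ⊕ (a ⊕ b) ≈ (𝟙 ⊕ b) ⊕ a
  regroup a b i = solve 3 (λ x y z → x :+ (y :+ z) := x :+ z :+ y) refl (𝟙 i) (a i) (b i)
  H-fixpoint : H ≈[ N ] 𝟙 ⊕ q^ j′ ⊛ H
  H-fixpoint = begin
    geom j′ (suc c) ⊛ G                              ≐⟨ ⊛-cong (geom-suc j′ c) ≈-refl ⟩
    (𝟙 ⊕ R) ⊛ G                                      ≐⟨ ⊛-distribʳ 𝟙 R G ⟩
    𝟙 ⊛ G ⊕ R ⊛ G                                    ≐⟨ ⊕-cong (⊛-identityˡ G) ≈-refl ⟩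
    G ⊕ R ⊛ G                                        ≈⟨ ⊕-cong[] (geom-fixpoint (j + c * j′)) ≈[]-refl ⟩
    (𝟙 ⊕ q^ (suc c * j′) ⊛ G) ⊕ R ⊛ G               ≐⟨ regroup (R ⊛ G) (q^ (suc c * j′) ⊛ G) ⟨
    𝟙 ⊕ (R ⊛ G ⊕ q^ (suc c * j′) ⊛ G)               ≐⟨ ⊕-cong ≈-refl (⊛-distribʳ R (q^ (suc c * j′)) G) ⟨
    𝟙 ⊕ (R ⊕ q^ (suc c * j′)) ⊛ G                    ≐⟨ ⊕-cong ≈-refl (⊛-cong shift ≈-refl) ⟨
    𝟙 ⊕ (q^ j′ ⊛ geom j′ (suc c)) ⊛ G                ≐⟨ ⊕-cong ≈-refl (⊛-assoc (q^ j′) (geom j′ (suc c)) G) ⟩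
    𝟙 ⊕ q^ j′ ⊛ H                                    ∎
    where open ≈[]-Reasoning N

-- Partitions counted by generating functions

count-cong : ∀ {A : Set} {p q : A → Bool} xs → (∀ x → p x ≡ q x) → count p xs ≡ count q xs
count-cong [] p≡q = refl
count-cong {p = p} {q} (x ∷ xs) p≡q with p x | q x | p≡q x
... | true  | .true  | refl = cong suc (count-cong xs p≡q)
... | false | .false | refl = count-cong xs p≡q

count-false : ∀ {A : Set} (xs : List A) → count (λ _ → false) xs ≡ 0
count-false []       = refl
count-false (x ∷ xs) = count-false xs

count-++ : ∀ {A : Set} (p : A → Bool) xs ys → count p (xs ++ ys) ≡ count p xs + count p ys
count-++ p []       ys = refl
count-++ p (x ∷ xs) ys with p x
... | true  = cong suc (count-++ p xs ys)
... | false = count-++ p xs ys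

count-map : ∀ {A B : Set} (p : B → Bool) (f : A → B) xs → count p (map f xs) ≡ count (p ∘ f) xs
count-map p f []       = refl
count-map p f (x ∷ xs) with p (f x)
... | true  = cong suc (count-map p f xs)
... | false = count-map p f xs

count-filter : ∀ {A : Set} {P : A → Set} (P? : Decidable P) (p : A → Bool) xs →
               count p (filter P? xs) ≡ count (λ x → does (P? x) ∧ p x) xs
count-filter P? p []       = refl
count-filter P? p (x ∷ xs) with does (P? x)
... | false = count-filter P? p xs
... | true with p x
...   | true  = cong suc (count-filter P? p xs)
...   | false = count-filter P? p xs

count-concatMap : ∀ {A : Set} (p : A → Bool) (G : ℕ → List A) (F : ℕ → Series) n →
                  (∀ x → count p (G x) ≡ F x n) →
                  ∀ c f → count p (concatMap G (applyUpTo f c)) ≡ (∑[ x < c ] F (f x)) n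
count-concatMap p G F n count≡ zero    f = refl
count-concatMap p G F n count≡ (suc c) f =
  trans (count-++ p (G (f 0)) (concatMap G (applyUpTo (f ∘ suc) c)))
        (cong₂ _+_ (count≡ (f 0)) (count-concatMap p G F n count≡ c (f ∘ suc)))

count-weight-shift : ∀ {A : Set} (w : A → ℕ) (p : A → Bool) (P : Series) xs →
                     (∀ n → count (λ a → (w a ≡ᵇ n) ∧ p a) xs ≡ P n) →
                     ∀ d n → count (λ a → (d + w a ≡ᵇ n) ∧ p a) xs ≡ (q^ d ⊛ P) n
count-weight-shift w p P xs count≡ d n with d ≤? n
... | yes d≤n = begin
  count (λ a → (d + w a ≡ᵇ n) ∧ p a) xs             ≡⟨ count-cong xs (λ a → cong (λ m → (d + w a ≡ᵇ m) ∧ p a) (m+[n∸m]≡n d≤n)) ⟨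
  count (λ a → (d + w a ≡ᵇ d + (n ∸ d)) ∧ p a) xs   ≡⟨ count-cong xs (λ a → cong (_∧ p a) (+-≡ᵇ-cancelˡ d (w a) (n ∸ d))) ⟩
  count (λ a → (w a ≡ᵇ n ∸ d) ∧ p a) xs             ≡⟨ count≡ (n ∸ d) ⟩
  P (n ∸ d)                                          ≡⟨ q^-⊛-at d P (n ∸ d) ⟨
  (q^ d ⊛ P) (d + (n ∸ d))                           ≡⟨ cong (q^ d ⊛ P) (m+[n∸m]≡n d≤n) ⟩
  (q^ d ⊛ P) n                                       ∎
  where
  open ≡-Reasoning
  +-≡ᵇ-cancelˡ : ∀ d m n → (d + m ≡ᵇ d + n) ≡ (m ≡ᵇ n)
  +-≡ᵇ-cancelˡ zero    m n = refl
  +-≡ᵇ-cancelˡ (suc d) m n = +-≡ᵇ-cancelˡ d m n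
... | no d≰n = begin
  count (λ a → (d + w a ≡ᵇ n) ∧ p a) xs  ≡⟨ count-cong xs (λ a → cong (_∧ p a) (dec-false (d + w a ≟ n) (too-heavy a))) ⟩
  count (λ _ → false) xs                 ≡⟨ count-false xs ⟩
  0                                      ≡⟨ q^-⊛-below d P n (≰⇒> d≰n) ⟨
  (q^ d ⊛ P) n                           ∎
  where
  open ≡-Reasoning
  too-heavy : ∀ a → d + w a ≢ n
  too-heavy a d+w≡n = d≰n (subst (d ≤_) d+w≡n (m≤m+n d (w a)))

allOK : (ℕ → ℕ → Bool) → ℕ → List ℕ → Bool
allOK ok k []       = true
allOK ok k (m ∷ ms) = ok k m ∧ allOK ok (suc k) ms

multiplicityGF : (ℕ → ℕ → Bool) → ℕ → ℕ → Series
multiplicityGF ok b k = ∑[ x < suc b ] (if ok k x then q^ (k * x) else 𝟘)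

count-vecs : ∀ ok b l k n →
             count (λ ms → (weightFrom k ms ≡ᵇ n) ∧ allOK ok k ms) (vecs l b) ≡ prod (multiplicityGF ok b) k l n
count-vecs ok b zero    k zero    = refl
count-vecs ok b zero    k (suc n) = refl
count-vecs ok b (suc l) k n = begin
  count p (concatMap (λ x → map (x ∷_) (vecs l b)) (upTo (suc b)))
    ≡⟨ count-concatMap p (λ x → map (x ∷_) (vecs l b)) (λ x → term x ⊛ P) n count-column (suc b) id ⟩
  (∑[ x < suc b ] (term x ⊛ P)) n
    ≡⟨ sum-⊛ (suc b) term P n ⟨
  (multiplicityGF ok b k ⊛ P) n ∎
  where
  open ≡-Reasoning
  p : List ℕ → Bool
  p ms = (weightFrom k ms ≡ᵇ n) ∧ allOK ok k ms
  P : Series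
  P = prod (multiplicityGF ok b) (suc k) l
  term : ℕ → Series
  term x = if ok k x then q^ (k * x) else 𝟘
  count-column : ∀ x → count p (map (x ∷_) (vecs l b)) ≡ (term x ⊛ P) n
  count-column x = trans (count-map p (x ∷_) (vecs l b)) (by-ok (ok k x))
    where
    by-ok : ∀ okx → count (λ ms → (k * x + weightFrom (suc k) ms ≡ᵇ n) ∧ (okx ∧ allOK ok (suc k) ms)) (vecs l b)
                    ≡ ((if okx then q^ (k * x) else 𝟘) ⊛ P) n
    by-ok true  = count-weight-shift (weightFrom (suc k)) (allOK ok (suc k)) P (vecs l b) (count-vecs ok b l (suc k)) (k * x) n
    by-ok false = begin
      count (λ ms → (k * x + weightFrom (suc k) ms ≡ᵇ n) ∧ false) (vecs l b) ≡⟨ count-cong (vecs l b) (λ ms → ∧-zeroʳ _) ⟩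
      count (λ _ → false) (vecs l b)                                          ≡⟨ count-false (vecs l b) ⟩
      0                                                                       ≡⟨ ⊛-zeroˡ P n ⟨
      (𝟘 ⊛ P) n                                                               ∎

count-partitionsOf : ∀ ok n → count (allOK ok 1) (partitionsOf n) ≡ prod (multiplicityGF ok n) 1 n n
count-partitionsOf ok n =
  trans (count-filter (λ ms → weightFrom 1 ms ≟ n) (allOK ok 1) (vecs n n)) (count-vecs ok n n 1 n)

partsOK∧multOK≡allOK : ∀ A t k ms → partsOK A k ms ∧ multOK t ms ≡ allOK (λ j x → ((x ≡ᵇ 0) ∨ A j) ∧ (x <ᵇ t)) k ms
partsOK∧multOK≡allOK A t k []       = refl
partsOK∧multOK≡allOK A t k (m ∷ ms) =
  trans (∧-interchange ((m ≡ᵇ 0) ∨ A k) (partsOK A (suc k) ms) (m <ᵇ t) (multOK t ms))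
        (cong ((((m ≡ᵇ 0) ∨ A k) ∧ (m <ᵇ t)) ∧_) (partsOK∧multOK≡allOK A t (suc k) ms))

partsOK≡allOK : ∀ B k ms → partsOK B k ms ≡ allOK (λ j x → (x ≡ᵇ 0) ∨ B j) k ms
partsOK≡allOK B k []       = refl
partsOK≡allOK B k (m ∷ ms) = cong (((m ≡ᵇ 0) ∨ B k) ∧_) (partsOK≡allOK B (suc k) ms)

if-≡ : ∀ {b c} (f g : Series) → b ≡ c → (if b then f else g) ≈ (if c then f else g)
if-≡ f g refl = ≈-refl

multiplicityGF-only-0 : ∀ ok b k → ok k 0 ≡ true → (∀ x → ok k (suc x) ≡ false) → multiplicityGF ok b k ≈ 𝟙
multiplicityGF-only-0 ok b k ok0 ok-suc i = begin
  (if ok k 0 then q^ (k * 0) else 𝟘) i + (∑[ x < b ] (if ok k (suc x) then q^ (k * suc x) else 𝟘)) i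
    ≡⟨ cong₂ _+_ (if-≡ _ 𝟘 ok0 i) (sum-zero[] b (λ x _ → ≈⇒≈[] (if-≡ _ 𝟘 (ok-suc x))) i ≤-refl) ⟩
  (q^ (k * 0)) i + 0 ≡⟨ +-identityʳ _ ⟩
  (q^ (k * 0)) i     ≡⟨ cong (λ d → (q^ d) i) (*-zeroʳ k) ⟩
  𝟙 i                ∎
  where open ≡-Reasoning

multiplicityGF-all : ∀ ok b k → (∀ x → ok k x ≡ true) → multiplicityGF ok b k ≈ geom k (suc b)
multiplicityGF-all ok b k ok≡ = sum-cong (suc b) (λ x _ → if-≡ (q^ (k * x)) 𝟘 (ok≡ x))

module _ {N : ℕ} (ok : ℕ → ℕ → Bool) (k t : ℕ) (ok≡ : ∀ x → ok (suc k) x ≡ (x <ᵇ t)) where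
  private
    term : ℕ → Series
    term x = if ok (suc k) x then q^ (suc k * x) else 𝟘

    below-t : ∀ x → x < t → term x ≈ q^ (suc k * x)
    below-t x x<t = if-≡ _ 𝟘 (trans (ok≡ x) (dec-true (x <? t) x<t))

    vanish-from-t : ∀ x → t ≤ x → term x ≈[ N ] 𝟘
    vanish-from-t x t≤x = ≈⇒≈[] (if-≡ _ 𝟘 (trans (ok≡ x) (dec-false (x <? t) (≤⇒≯ t≤x))))

    vanish-above-N : ∀ x → suc N ≤ x → term x ≈[ N ] 𝟘
    vanish-above-N x N<x with ok (suc k) x
    ... | true  = q^-vanish (suc k * x) (<-≤-trans N<x (m≤n*m x (suc k)))
    ... | false = ≈[]-refl

  multiplicityGF-below : multiplicityGF ok N (suc k) ≈[ N ] geom (suc k) t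
  multiplicityGF-below with ≤-total t (suc N)
  ... | inj₁ t≤N+1 = begin
    sum (suc N) term   ≈⟨ sum-truncate t vanish-from-t t≤N+1 ⟩
    sum t term         ≐⟨ sum-cong t below-t ⟩
    geom (suc k) t     ∎
    where open ≈[]-Reasoning N
  ... | inj₂ N+1≤t = begin
    sum (suc N) term   ≈⟨ sum-truncate (suc N) vanish-above-N N+1≤t ⟨
    sum t term         ≐⟨ sum-cong t below-t ⟩
    geom (suc k) t     ∎
    where open ≈[]-Reasoning N

-- The identity for abstract classes of parts

when : Bool → Series → Series
when b f = if b then f else 𝟙

when-cong[] : ∀ {N} b {f g} → f ≈[ N ] g → when b f ≈[ N ] when b g
when-cong[] true  f≈g = f≈g
when-cong[] false f≈g = ≈[]-refl

when-⊛ : ∀ b f g → when b f ⊛ when b g ≈ when b (f ⊛ g)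
when-⊛ true  f g = ≈-refl
when-⊛ false f g = ⊛-identityˡ 𝟙

when-split : ∀ a b f → when (a ∧ not b) f ⊛ when (a ∧ b) f ≈ when a f
when-split true  true  f = ⊛-identityˡ f
when-split true  false f = ⊛-identityʳ f
when-split false b     f = ⊛-identityˡ 𝟙

when-𝟙 : ∀ {N} b {f} → f ≈[ N ] 𝟙 → when b f ≈[ N ] 𝟙
when-𝟙 true  f≈𝟙 = f≈𝟙
when-𝟙 false f≈𝟙 = ≈[]-refl

when-constant-term : ∀ b {f} → f 0 ≡ 1 → when b f 0 ≡ 1
when-constant-term true  f0≡1 = f0≡1
when-constant-term false f0≡1 = refl

module Glaisher (N t′ : ℕ) (A T : ℕ → Bool)
                (A∧T-multiple : ∀ j → A (suc t′ * j) ∧ T (suc t′ * j) ≡ A j)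
                (T-non-multiple : ∀ k → suc t′ ∤ k → T k ≡ false) where
  private
    t = suc t′

  okC okE : ℕ → ℕ → Bool
  okC j x = ((x ≡ᵇ 0) ∨ A j) ∧ (x <ᵇ t)
  okE j x = (x ≡ᵇ 0) ∨ (A j ∧ not (T j))

  G : ℕ → Series
  G j = geom j (suc N)

  C-factor : ∀ j → multiplicityGF okC N (suc j) ≈[ N ] when (A (suc j)) (geom (suc j) t)
  C-factor j = by-A (A (suc j)) refl
    where
    by-A : ∀ a → A (suc j) ≡ a → multiplicityGF okC N (suc j) ≈[ N ] when a (geom (suc j) t)
    by-A true  A≡ = multiplicityGF-below okC j t λ x →
      trans (cong (λ a → ((x ≡ᵇ 0) ∨ a) ∧ (x <ᵇ t)) A≡) (cong (_∧ (x <ᵇ t)) (∨-zeroʳ (x ≡ᵇ 0)))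
    by-A false A≡ = ≈⇒≈[] (multiplicityGF-only-0 okC N (suc j) refl λ x → cong (_∧ (suc x <ᵇ t)) A≡)

  E-factor : ∀ j → multiplicityGF okE N j ≈ when (A j ∧ not (T j)) (G j)
  E-factor j = by-B (A j ∧ not (T j)) refl
    where
    by-B : ∀ b → A j ∧ not (T j) ≡ b → multiplicityGF okE N j ≈ when b (G j)
    by-B true  B≡ = multiplicityGF-all okE N j λ x → trans (cong ((x ≡ᵇ 0) ∨_) B≡) (∨-zeroʳ (x ≡ᵇ 0))
    by-B false B≡ = multiplicityGF-only-0 okE N j refl λ _ → B≡

  C-step : ∀ j → multiplicityGF okC N (suc j) ⊛ when (A (suc j)) (G (t * suc j)) ≈[ N ] when (A (suc j)) (G (suc j))
  C-step j = begin
    multiplicityGF okC N (suc j) ⊛ when (A (suc j)) (G (t * suc j))     ≈⟨ ⊛-cong[] (C-factor j) ≈[]-refl ⟩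
    when (A (suc j)) (geom (suc j) t) ⊛ when (A (suc j)) (G (t * suc j)) ≐⟨ when-⊛ (A (suc j)) _ _ ⟩
    when (A (suc j)) (geom (suc j) t ⊛ G (t * suc j))                    ≈⟨ when-cong[] (A (suc j)) (geom-⊛-geom j t′) ⟩
    when (A (suc j)) (G (suc j))                                         ∎
    where open ≈[]-Reasoning N

  E-step : ∀ j → multiplicityGF okE N j ⊛ when (A j ∧ T j) (G j) ≈ when (A j) (G j)
  E-step j i = trans (⊛-cong (E-factor j) ≈-refl i) (when-split (A j) (T j) (G j) i)

  XG YG : ℕ → Series
  XG j = when (A j) (G (t * j))
  YG j = when (A j ∧ T j) (G j)

  PC PE X Y PA : Series
  PC = prod (multiplicityGF okC N) 1 N
  PE = prod (multiplicityGF okE N) 1 N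
  X  = prod XG 1 N
  Y  = prod YG 1 N
  PA = prod (λ j → when (A j) (G j)) 1 N

  PC⊛X : PC ⊛ X ≈[ N ] PA
  PC⊛X = begin
    PC ⊛ X                                                                      ≐⟨ prod-⊛ _ _ 1 N ⟩
    prod (λ j → multiplicityGF okC N j ⊛ XG j) 1 N                             ≈⟨ prod-cong[] 1 N (λ d _ → C-step d) ⟩
    PA                                                                          ∎
    where open ≈[]-Reasoning N

  PE⊛Y : PE ⊛ Y ≈[ N ] PA
  PE⊛Y = begin
    PE ⊛ Y                                                                      ≐⟨ prod-⊛ _ _ 1 N ⟩
    prod (λ j → multiplicityGF okE N j ⊛ YG j) 1 N                             ≈⟨ prod-cong[] 1 N (λ d _ → ≈⇒≈[] (E-step (suc d))) ⟩
    PA                                                                          ∎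
    where open ≈[]-Reasoning N

  X-constant-term : X 0 ≡ 1
  X-constant-term = prod-constant-term _ 1 N λ where
    (suc j) _ → when-constant-term (A (suc j)) (geom-constant-term (j + t′ * suc j) N)

  private
    M r : ℕ
    M = N / t
    r = N % t

    N≡ : t * M + r ≡ N
    N≡ = trans (+-comm (t * M) r) (trans (cong (r +_) (*-comm t M)) (sym (m≡m%n+[m/n]*n N t)))

    N<t*[M+1+d] : ∀ d → N < t * (suc M + d)
    N<t*[M+1+d] d = begin-strict
      N                ≡⟨ N≡ ⟨
      t * M + r        <⟨ +-monoʳ-< (t * M) (m%n<n N t) ⟩
      t * M + t        ≡⟨ +-comm (t * M) t ⟩
      t + t * M        ≡⟨ *-suc t M ⟨
      t * suc M        ≤⟨ *-monoʳ-≤ t (m≤m+n (suc M) d) ⟩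
      t * (suc M + d)  ∎
      where open ≤-Reasoning

  X-truncate : X ≈[ N ] prod XG 1 M
  X-truncate = begin
    X                                              ≡⟨ cong (prod XG 1) (trans (sym N≡) (+-assoc M (t′ * M) r)) ⟩
    prod XG 1 (M + (t′ * M + r))                   ≐⟨ prod-+ XG 1 M (t′ * M + r) ⟩
    prod XG 1 M ⊛ prod XG (suc M) (t′ * M + r)     ≈⟨ ⊛-cong[] ≈[]-refl beyond-M ⟩
    prod XG 1 M ⊛ 𝟙                                ≐⟨ ⊛-identityʳ _ ⟩
    prod XG 1 M                                    ∎
    where
    open ≈[]-Reasoning N
    beyond-M : prod XG (suc M) (t′ * M + r) ≈[ N ] 𝟙
    beyond-M = prod-trivial[] (suc M) (t′ * M + r) λ d _ →
      when-𝟙 (A (suc M + d)) (geom-𝟙 (t * (suc M + d)) (N<t*[M+1+d] d))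

  Y≈X : Y ≈[ N ] X
  Y≈X = begin
    Y                           ≡⟨ cong (prod YG 1) N≡ ⟨
    prod YG 1 (t * M + r)       ≈⟨ prod-multiples t′ YG YG-non-multiple M r (≤-pred (m%n<n N t)) ⟩
    prod (YG ∘ (t *_)) 1 M      ≈⟨ prod-cong[] 1 M (λ d _ → ≈⇒≈[] (if-≡ _ 𝟙 (A∧T-multiple (suc d)))) ⟩
    prod XG 1 M                 ≈⟨ X-truncate ⟨
    X                           ∎
    where
    open ≈[]-Reasoning N
    YG-non-multiple : ∀ k → t ∤ k → YG k ≈[ N ] 𝟙
    YG-non-multiple k t∤k = ≈⇒≈[] (if-≡ (G k) 𝟙 (trans (cong (A k ∧_) (T-non-multiple k t∤k)) (∧-zeroʳ (A k))))

  PC≈PE : PC ≈[ N ] PE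
  PC≈PE = ⊛-cancelˡ[] X PC PE X-constant-term (begin
    X ⊛ PC   ≐⟨ ⊛-comm X PC ⟩
    PC ⊛ X   ≈⟨ PC⊛X ⟩
    PA       ≈⟨ PE⊛Y ⟨
    PE ⊛ Y   ≈⟨ ⊛-cong[] ≈[]-refl Y≈X ⟩
    PE ⊛ X   ≐⟨ ⊛-comm PE X ⟩
    X ⊛ PE   ∎)
    where open ≈[]-Reasoning N

-- The classes of the theorem

any-applyUpTo-true : ∀ (P : ℕ → Bool) f {r} n → r < n → P (f r) ≡ true → any P (applyUpTo f n) ≡ true
any-applyUpTo-true P f {zero}  (suc n) _         Pfr = cong (_∨ any P (applyUpTo (f ∘ suc) n)) Pfr
any-applyUpTo-true P f {suc r} (suc n) (s≤s r<n) Pfr =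
  trans (cong (P (f 0) ∨_) (any-applyUpTo-true P (f ∘ suc) n r<n Pfr)) (∨-zeroʳ (P (f 0)))

any-applyUpTo-false : ∀ (P : ℕ → Bool) f n → (∀ r → r < n → P (f r) ≡ false) → any P (applyUpTo f n) ≡ false
any-applyUpTo-false P f zero    _  = refl
any-applyUpTo-false P f (suc n) Pf = cong₂ _∨_ (Pf 0 z<s) (any-applyUpTo-false P (f ∘ suc) n (λ r r<n → Pf (suc r) (s<s r<n)))

even⇒≡2*[m/2] : ∀ m → m % 2 ≡ 0 → m ≡ 2 * (m / 2)
even⇒≡2*[m/2] m m-even = trans (m≡m%n+[m/n]*n m 2) (trans (cong (_+ m / 2 * 2) m-even) (*-comm (m / 2) 2))

odd⇒≡2*[m/2]+1 : ∀ m → m % 2 ≡ 1 → m ≡ 2 * (m / 2) + 1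
odd⇒≡2*[m/2]+1 m m-odd =
  trans (m≡m%n+[m/n]*n m 2) (trans (cong (_+ m / 2 * 2) m-odd) (trans (+-comm 1 _) (cong (_+ 1) (*-comm (m / 2) 2))))

[2*m]%2≡0 : ∀ m → (2 * m) % 2 ≡ 0
[2*m]%2≡0 m = trans (cong (_% 2) (*-comm 2 m)) (m*n%n≡0 m 2)

[2*m+1]%2≡1 : ∀ m → (2 * m + 1) % 2 ≡ 1
[2*m+1]%2≡1 m = trans (cong (_% 2) (trans (+-comm (2 * m) 1) (cong suc (*-comm 2 m)))) ([m+kn]%n≡m%n 1 m 2)

m%2≢1⇒m%2≡0 : ∀ m → m % 2 ≢ 1 → m % 2 ≡ 0
m%2≢1⇒m%2≡0 m m%2≢1 with m % 2 | m%n<n m 2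
... | zero        | _             = refl
... | suc zero    | _             = contradiction refl m%2≢1
... | suc (suc _) | s<s (s<s ())

module ResidueClasses (s₀ : ℕ) (s-even : suc s₀ % 2 ≡ 0) where
  private
    s h : ℕ
    s = suc s₀
    h = s / 2

    s≡2*h : s ≡ 2 * h
    s≡2*h = even⇒≡2*[m/2] s s-even

    %s%2 : ∀ k → k % s % 2 ≡ k % 2
    %s%2 k = m∣n⇒o%n%m≡o%m 2 s k (m%n≡0⇒n∣m s 2 s-even)

  Allowed : ℕ → Set
  Allowed k = k % s ≡ 0 ⊎ k % 2 ≡ 1

  allowed? : ∀ k → Dec (Allowed k)
  allowed? k = (k % s ≟ 0) ⊎-dec (k % 2 ≟ 1)

  evenClass-allowed : ∀ {k} → Allowed k → evenClass s k ≡ false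
  evenClass-allowed {k} allowed = any-applyUpTo-false _ id (h ∸ 1) λ r _ → dec-false (k % s ≟ 2 * suc r) (≢ allowed r)
    where
    ≢ : Allowed k → ∀ r → k % s ≢ 2 * suc r
    ≢ (inj₁ k%s≡0) r k%s≡ = 0≢1+n (trans (sym k%s≡0) k%s≡)
    ≢ (inj₂ k-odd) r k%s≡ = 0≢1+n (begin
      0                  ≡⟨ [2*m]%2≡0 (suc r) ⟨
      (2 * suc r) % 2    ≡⟨ cong (_% 2) k%s≡ ⟨
      k % s % 2          ≡⟨ %s%2 k ⟩
      k % 2              ≡⟨ k-odd ⟩
      1                  ∎)
      where open ≡-Reasoning

  evenClass-not-allowed : ∀ {k} → ¬ Allowed k → evenClass s k ≡ true
  evenClass-not-allowed {k} not-allowed = from-half (k % s / 2) (even⇒≡2*[m/2] (k % s) k%s-even)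
    where
    k%s-even : k % s % 2 ≡ 0
    k%s-even = trans (%s%2 k) (m%2≢1⇒m%2≡0 k (not-allowed ∘ inj₂))
    from-half : ∀ q → k % s ≡ 2 * q → evenClass s k ≡ true
    from-half zero    k%s≡0 = contradiction (inj₁ k%s≡0) not-allowed
    from-half (suc r) k%s≡  = any-applyUpTo-true _ id (h ∸ 1) r<h∸1 (dec-true (k % s ≟ 2 * suc r) k%s≡)
      where
      r<h∸1 : r < h ∸ 1
      r<h∸1 = ∸-monoˡ-≤ 1 (*-cancelˡ-< 2 (suc r) h (subst₂ _<_ k%s≡ s≡2*h (m%n<n k s)))

  not-evenClass : ∀ k → not (evenClass s k) ≡ does (allowed? k)
  not-evenClass k = by-dec (allowed? k)
    where
    by-dec : (a? : Dec (Allowed k)) → not (evenClass s k) ≡ does a?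
    by-dec (yes allowed)     = cong not (evenClass-allowed {k} allowed)
    by-dec (no  not-allowed) = cong not (evenClass-not-allowed {k} not-allowed)

  module _ (t₀ : ℕ) where
    private
      t : ℕ
      t = suc t₀

      [t*j]%[t*s] : ∀ j → (t * j) % (t * s) ≡ t * (j % s)
      [t*j]%[t*s] j = begin
        (t * j) % (t * s)  ≡⟨ cong (_% (t * s)) (*-comm t j) ⟩
        (j * t) % (t * s)  ≡⟨ %-congʳ {o = j * t} (*-comm t s) ⟩
        (j * t) % (s * t)  ≡⟨ m%n*o≡m*o%[n*o] j s t ⟨
        j % s * t          ≡⟨ *-comm (j % s) t ⟩
        t * (j % s)        ∎
        where open ≡-Reasoning

    tClass-multiple : ∀ j → tClass s t (t * j) ≡ does (allowed? j)
    tClass-multiple j = trans (cong classes ([t*j]%[t*s] j)) (by-dec (allowed? j))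
      where
      classes : ℕ → Bool
      classes ρ = (ρ ≡ᵇ 0) ∨ any (λ r → ρ ≡ᵇ t * (2 * r + 1)) (upTo h)
      ρ = j % s
      by-dec : (a? : Dec (Allowed j)) → classes (t * ρ) ≡ does a?
      by-dec (yes (inj₁ ρ≡0)) = cong (_∨ any (λ r → t * ρ ≡ᵇ t * (2 * r + 1)) (upTo h))
        (dec-true (t * ρ ≟ 0) (trans (cong (t *_) ρ≡0) (*-zeroʳ t)))
      by-dec (yes (inj₂ j-odd)) = trans (cong ((t * ρ ≡ᵇ 0) ∨_) odd-class) (∨-zeroʳ _)
        where
        ρ≡ : ρ ≡ 2 * (ρ / 2) + 1
        ρ≡ = odd⇒≡2*[m/2]+1 ρ (trans (%s%2 j) j-odd)
        ρ/2<h : ρ / 2 < h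
        ρ/2<h = m<n*o⇒m/o<n (subst (ρ <_) (trans s≡2*h (*-comm 2 h)) (m%n<n j s))
        odd-class : any (λ r → t * ρ ≡ᵇ t * (2 * r + 1)) (upTo h) ≡ true
        odd-class = any-applyUpTo-true _ id h ρ/2<h (dec-true (t * ρ ≟ _) (cong (t *_) ρ≡))
      by-dec (no not-allowed) = cong₂ _∨_
        (dec-false (t * ρ ≟ 0) (λ tρ≡0 → not-allowed (inj₁ (m*n≡0⇒m≡0 ρ t (trans (*-comm ρ t) tρ≡0)))))
        (any-applyUpTo-false _ id h λ r _ → dec-false (t * ρ ≟ _) λ tρ≡ →
          not-allowed (inj₂ (trans (sym (%s%2 j)) (trans (cong (_% 2) (*-cancelˡ-≡ ρ _ t tρ≡)) ([2*m+1]%2≡1 r)))))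

    tClass-non-multiple : ∀ k → t ∤ k → tClass s t k ≡ false
    tClass-non-multiple k t∤k = cong₂ _∨_
      (dec-false (k % (t * s) ≟ 0) (λ k%ts≡0 → t∤k (divides-residue (trans k%ts≡0 (sym (*-zeroʳ t))))))
      (any-applyUpTo-false _ id h λ r _ → dec-false (k % (t * s) ≟ _) (t∤k ∘ divides-residue))
      where
      divides-residue : ∀ {c} → k % (t * s) ≡ t * c → t ∣ k
      divides-residue {c} k%ts≡ = m%n≡0⇒n∣m k t (begin
        k % t                ≡⟨ m∣n⇒o%n%m≡o%m t (t * s) k (m∣m*n s) ⟨
        k % (t * s) % t      ≡⟨ cong (_% t) (trans k%ts≡ (*-comm t c)) ⟩
        c * t % t            ≡⟨ m*n%n≡0 c t ⟩
        0                    ∎)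
        where open ≡-Reasoning

    allowed-* : Allowed t → ∀ {j} → Allowed j → Allowed (t * j)
    allowed-* (inj₁ t%s≡0) {j} _            = inj₁ (n∣m⇒m%n≡0 (t * j) s (∣-trans (m%n≡0⇒n∣m t s t%s≡0) (m∣m*n j)))
    allowed-* _            {j} (inj₁ j%s≡0) = inj₁ (n∣m⇒m%n≡0 (t * j) s (∣-trans (m%n≡0⇒n∣m j s j%s≡0) (n∣m*n t)))
    allowed-* (inj₂ t-odd) {j} (inj₂ j-odd) = inj₂ (trans (%-distribˡ-* t j 2) (cong₂ (λ a b → (a * b) % 2) t-odd j-odd))

    t-allowed : evenClass s t ≡ false → Allowed t
    t-allowed evenClass≡false with allowed? t
    ... | yes allowed     = allowed
    ... | no  not-allowed = contradiction (trans (sym (evenClass-not-allowed {t} not-allowed)) evenClass≡false) λ ()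

    A∧T-multiple : evenClass s t ≡ false → ∀ j → not (evenClass s (t * j)) ∧ tClass s t (t * j) ≡ not (evenClass s j)
    A∧T-multiple evenClass≡false j = begin
      not (evenClass s (t * j)) ∧ tClass s t (t * j)   ≡⟨ cong₂ _∧_ (not-evenClass (t * j)) (tClass-multiple j) ⟩
      does (allowed? (t * j)) ∧ does (allowed? j)      ≡⟨ absorb (allowed? j) ⟩
      does (allowed? j)                                ≡⟨ not-evenClass j ⟨
      not (evenClass s j)                              ∎
      where
      open ≡-Reasoning
      absorb : (a? : Dec (Allowed j)) → does (allowed? (t * j)) ∧ does a? ≡ does a?
      absorb (yes allowed) = cong (_∧ true) (dec-true (allowed? (t * j)) (allowed-* (t-allowed evenClass≡false) {j} allowed))
      absorb (no _)        = ∧-zeroʳ _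

theorem15 : (s t : ℕ) → 4 ≤ s → s % 2 ≡ 0 → 3 ≤ t → evenClass s t ≡ false →
    (n : ℕ) → C s t n ≡ E s t n
theorem15 s@(suc s₀) t@(suc t₀) _ s-even _ evenClass≡false n = begin
  C s t n                               ≡⟨ count-cong (partitionsOf n) (λ ms → partsOK∧multOK≡allOK A t 1 ms) ⟩
  count (allOK okC 1) (partitionsOf n)  ≡⟨ count-partitionsOf okC n ⟩
  PC n                                  ≡⟨ PC≈PE n ≤-refl ⟩
  PE n                                  ≡⟨ count-partitionsOf okE n ⟨
  count (allOK okE 1) (partitionsOf n)  ≡⟨ count-cong (partitionsOf n) (λ ms → partsOK≡allOK (λ k → A k ∧ not (T k)) 1 ms) ⟨
  E s t n                               ∎
  where
  open ≡-Reasoning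
  open ResidueClasses s₀ s-even
  A T : ℕ → Bool
  A k = not (evenClass s k)
  T k = tClass s t k
  open Glaisher n t₀ A T (A∧T-multiple t₀ evenClass≡false) (tClass-non-multiple t₀)
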